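{- For $n\ge1$ let $C_n(y)=\sum_{k=0}^{n-1}y^{\,n-k-1}T(n-1,k)$, where $T(m,k)=\frac{(m+k)!}{(m-k)!\,k!}$. Then for all $n\ge2$, $$C_n(y)-2\frac{d}{dy}C_n(y)=y\,C_{n-1}(y).$$ -}

module Defs where

open import Data.Nat as ℕ using (ℕ; zero; suc; _∸_; _!)
open import Data.Nat.Properties using (_!*_!≢0)
open import Data.Nat.DivMod using (_/_)
open import Data.Integer as ℤ using (ℤ; +_; _+_; _-_; _*_)
open import Data.Bool using (if_then_else_)

-- T(m,k) = (m+k)! / ((m-k)! k!)   (exact division for k ≤ m, the only range used)
T : ℕ → ℕ → ℕ
T m k = ((m ℕ.+ k) !) / ((m ∸ k) ! ℕ.* k !)
  where instance _ = (m ∸ k) !* k !≢0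

-- Polynomials in y with integer coefficients, represented by their
-- coefficient sequence: p i is the coefficient of y^i.
-- Equality of polynomials = pointwise equality of coefficients.
Poly : Set
Poly = ℕ → ℤ

0ₚ : Poly
0ₚ _ = + 0

_+ₚ_ : Poly → Poly → Poly
(p +ₚ q) i = p i + q i

_-ₚ_ : Poly → Poly → Poly
(p -ₚ q) i = p i - q i

_·ₚ_ : ℤ → Poly → Poly
(c ·ₚ p) i = c * p i

Y^ : ℕ → Poly
Y^ d i = if d ℕ.≡ᵇ i then + 1 else + 0

yₚ* : Poly → Poly
yₚ* p zero    = + 0
yₚ* p (suc i) = p i

D : Poly → Poly
D p i = + (suc i) * p (suc i)

Σₚ : ℕ → (ℕ → Poly) → Poly
Σₚ zero    f = 0ₚ
Σₚ (suc n) f = Σₚ n f +ₚ f n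

C : ℕ → Poly
C n = Σₚ n (λ k → (+ T (n ∸ 1) k) ·ₚ Y^ (n ∸ k ∸ 1))

-- The only nonzero coefficients of C (m + 1) are [y^i] C (m + 1) = T m s with
-- i + s = m.  Comparing coefficients of y^i, the identity becomes a recurrence
-- along the antidiagonals, T m s = 2 (i + 1) T m (s - 1) + T (m - 1) s for
-- i, s ≥ 1, with boundary cases T m m = 2 T m (m - 1) and T m 0 = 1.
-- Multiplied by i! s! every T becomes a factorial, and the recurrence reduces
-- to (m + s) = 2 s + i, i.e. to m = i + s.
module Submission where

open import Defs
open import Data.Nat
  using (ℕ; zero; suc; _+_; _*_; _∸_; _≤_; _<_; _!; s≤s; compare; less; equal; greater)
open import Data.Nat.Properties
  using ( m≤m+n; m+n∸n≡m; m+n∸m≡n; m∸n≤m; m∸[m∸n]≡n; ∸-+-assoc; +-comm; +-suc; *-zeroʳ; *-distribʳ-+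
        ; *-identityˡ; *-identityʳ; +-identityʳ; *-cancelʳ-≡; _!*_!≢0
        ; ≤-refl; ≤-pred; ≤-<-trans; m<n⇒m<1+n; m≤n⇒m<n∨m≡n; <-irrefl )
open import Data.Nat.DivMod using (m/n*n≡m)
open import Data.Nat.Divisibility using (∣-trans; m≤n⇒m!∣n!)
open import Data.Nat.Combinatorics using ([n∸k]!k!∣n!)
open import Data.Nat.Tactic.RingSolver using (solve-∀)
open import Data.Integer as ℤ using (ℤ; +_; _⊖_)
import Data.Integer.Properties as ℤ
open import Data.Sum using (inj₁; inj₂)
open import Relation.Binary.PropositionalEquality
open import Data.Empty using (⊥-elim)
open import Function using (_∘_)
open ≡-Reasoning

T-factorial : ∀ {m} i s → m ≡ i + s → T m s * (i ! * s !) ≡ (m + s) !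
T-factorial i s refl = subst (λ j → T (i + s) s * (j ! * s !) ≡ (i + s + s) !)
  (m+n∸n≡m i s)
  (m/n*n≡m {{((i + s) ∸ s) !* s !≢0}} (∣-trans ([n∸k]!k!∣n! s≤i+s) (m≤n⇒m!∣n! (m≤m+n (i + s) s))))
  where
  s≤i+s : s ≤ i + s
  s≤i+s = subst (s ≤_) (+-comm s i) (m≤m+n s i)

T-unique : ∀ {m} i s a → m ≡ i + s → a * (i ! * s !) ≡ (m + s) ! → T m s ≡ a
T-unique i s a m≡i+s a-factorial = *-cancelʳ-≡ (T _ s) a (i ! * s !) {{i !* s !≢0}}
  (trans (T-factorial i s m≡i+s) (sym a-factorial))

T-zeroʳ : ∀ m → T m 0 ≡ 1
T-zeroʳ m = T-unique m 0 1 (sym (+-identityʳ m)) (begin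
  1 * (m ! * 1)  ≡⟨ trans (*-identityˡ _) (*-identityʳ _) ⟩
  m !            ≡⟨ cong _! (+-identityʳ m) ⟨
  (m + 0) !      ∎)

T-diagonal : ∀ r → T (suc r) (suc r) ≡ 2 * T (suc r) r
T-diagonal r = T-unique 0 (suc r) (2 * a) refl (begin
  2 * a * (1 * (suc r * r !))        ≡⟨ rearrange (suc r) a (r !) ⟩
  2 * suc r * (a * (1 * r !))        ≡⟨ cong (2 * suc r *_) (T-factorial 1 r refl) ⟩
  2 * suc r * (suc r + r) !          ≡⟨ cong (_* (suc r + r) !) (double r) ⟩
  suc (suc r + r) * (suc r + r) !    ≡⟨ cong _! (+-suc (suc r) r) ⟨
  (suc r + suc r) !                  ∎)
  where
  a : ℕ
  a = T (suc r) r
  rearrange : ∀ x a f → 2 * a * (1 * (x * f)) ≡ 2 * x * (a * (1 * f))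
  rearrange = solve-∀
  double : ∀ r → 2 * suc r ≡ suc (suc r + r)
  double = solve-∀

T-recurrence : ∀ j r → T (2 + j + r) (suc r) ≡ 2 * ((2 + j) * T (2 + j + r) r) + T (suc (j + r)) (suc r)
T-recurrence j r = T-unique (suc j) (suc r) (2 * ((2 + j) * a) + b) (cong suc (sym (+-suc j r))) (begin
  (2 * ((2 + j) * a) + b) * ((suc j) ! * (suc r) !)
    ≡⟨ rearrange j r a b (j !) (r !) ⟩
  2 * suc r * (a * ((2 + j) ! * r !)) + suc j * (b * (j ! * (suc r) !))
    ≡⟨ cong₂ (λ x y → 2 * suc r * x + suc j * y) (T-factorial (2 + j) r refl) (T-factorial j (suc r) (sym (+-suc j r))) ⟩
  2 * suc r * (m + r) ! + suc j * (suc (j + r) + suc r) !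
    ≡⟨ cong (λ k → 2 * suc r * (m + r) ! + suc j * k !) (cong suc (+-suc (j + r) r)) ⟩
  2 * suc r * (m + r) ! + suc j * (m + r) !
    ≡⟨ *-distribʳ-+ ((m + r) !) (2 * suc r) (suc j) ⟨
  (2 * suc r + suc j) * (m + r) !
    ≡⟨ cong (_* (m + r) !) (antidiagonal j r) ⟩
  suc (m + r) * (m + r) !
    ≡⟨ cong _! (+-suc m r) ⟨
  (m + suc r) !
    ∎)
  where
  m a b : ℕ
  m = 2 + j + r
  a = T m r
  b = T (suc (j + r)) (suc r)
  rearrange : ∀ j r a b J R →
    (2 * ((2 + j) * a) + b) * ((suc j * J) * (suc r * R)) ≡
    2 * suc r * (a * ((2 + j) * (suc j * J) * R)) + suc j * (b * (J * (suc r * R)))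
  rearrange = solve-∀
  antidiagonal : ∀ j r → 2 * suc r + suc j ≡ suc (2 + j + r + r)
  antidiagonal = solve-∀

monomial-coefficient-≡ : ∀ a i → (a ·ₚ Y^ i) i ≡ a
monomial-coefficient-≡ a i = trans (cong (a ℤ.*_) (Y^-diagonal i)) (ℤ.*-identityʳ a)
  where
  Y^-diagonal : ∀ i → Y^ i i ≡ + 1
  Y^-diagonal zero    = refl
  Y^-diagonal (suc i) = Y^-diagonal i

monomial-coefficient-≢ : ∀ a {d i} → d ≢ i → (a ·ₚ Y^ d) i ≡ + 0
monomial-coefficient-≢ a d≢i = trans (cong (a ℤ.*_) (Y^-off-diagonal d≢i)) (ℤ.*-zeroʳ a)
  where
  Y^-off-diagonal : ∀ {d i} → d ≢ i → Y^ d i ≡ + 0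
  Y^-off-diagonal {zero}  {zero}  d≢i = ⊥-elim (d≢i refl)
  Y^-off-diagonal {zero}  {suc i} d≢i = refl
  Y^-off-diagonal {suc d} {zero}  d≢i = refl
  Y^-off-diagonal {suc d} {suc i} d≢i = Y^-off-diagonal (d≢i ∘ cong suc)

Σₚ-vanishing : ∀ n f i → (∀ k → k < n → f k i ≡ + 0) → Σₚ n f i ≡ + 0
Σₚ-vanishing zero    f i f≡0 = refl
Σₚ-vanishing (suc n) f i f≡0 =
  cong₂ ℤ._+_ (Σₚ-vanishing n f i (λ k k<n → f≡0 k (m<n⇒m<1+n k<n))) (f≡0 n ≤-refl)

Σₚ-single : ∀ n f i {j} → j < n → (∀ k → k < n → k ≢ j → f k i ≡ + 0) → Σₚ n f i ≡ f j i
Σₚ-single (suc n) f i {j} j<1+n f≡0 with m≤n⇒m<n∨m≡n (≤-pred j<1+n)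
... | inj₂ refl = begin
  Σₚ n f i ℤ.+ f n i  ≡⟨ cong (ℤ._+ f n i) (Σₚ-vanishing n f i (λ k k<n → f≡0 k (m<n⇒m<1+n k<n) (λ { refl → <-irrefl refl k<n }))) ⟩
  + 0 ℤ.+ f n i       ≡⟨ ℤ.+-identityˡ (f n i) ⟩
  f n i               ∎
... | inj₁ j<n = begin
  Σₚ n f i ℤ.+ f n i  ≡⟨ cong₂ ℤ._+_ (Σₚ-single n f i j<n (λ k k<n → f≡0 k (m<n⇒m<1+n k<n))) (f≡0 n ≤-refl (λ { refl → <-irrefl refl j<n })) ⟩
  f j i ℤ.+ + 0       ≡⟨ ℤ.+-identityʳ (f j i) ⟩
  f j i               ∎

C-exponent : ∀ m k → suc m ∸ k ∸ 1 ≡ m ∸ k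
C-exponent m k = trans (∸-+-assoc (suc m) k 1) (cong (suc m ∸_) (+-comm k 1))

C-coefficient : ∀ {m} i s → m ≡ i + s → C (suc m) i ≡ + T m s
C-coefficient i s refl = trans
  (Σₚ-single (suc m) (λ k → (+ T m k) ·ₚ Y^ (suc m ∸ k ∸ 1)) i (s≤s s≤m) other-terms-vanish)
  (subst (λ d → ((+ T m s) ·ₚ Y^ d) i ≡ + T m s) (sym (trans (C-exponent m s) (m+n∸n≡m i s)))
    (monomial-coefficient-≡ (+ T m s) i))
  where
  m : ℕ
  m = i + s
  s≤m : s ≤ m
  s≤m = subst (s ≤_) (+-comm s i) (m≤m+n s i)
  exponent-injective : ∀ k → k ≤ m → m ∸ k ≡ i → k ≡ s
  exponent-injective k k≤m m∸k≡i = begin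
    k              ≡⟨ m∸[m∸n]≡n k≤m ⟨
    m ∸ (m ∸ k)    ≡⟨ cong (m ∸_) m∸k≡i ⟩
    m ∸ i          ≡⟨ m+n∸m≡n i s ⟩
    s              ∎
  other-terms-vanish : ∀ k → k < suc m → k ≢ s → ((+ T m k) ·ₚ Y^ (suc m ∸ k ∸ 1)) i ≡ + 0
  other-terms-vanish k k<1+m k≢s = monomial-coefficient-≢ (+ T m k)
    (k≢s ∘ exponent-injective k (≤-pred k<1+m) ∘ trans (sym (C-exponent m k)))

C-coefficient-vanishing : ∀ m {i} → m < i → C (suc m) i ≡ + 0
C-coefficient-vanishing m {i} m<i = Σₚ-vanishing (suc m) _ i (λ k _ →
  monomial-coefficient-≢ (+ T m k) λ exponent≡i →
    <-irrefl refl (≤-<-trans (subst (_≤ m) (trans (sym (C-exponent m k)) exponent≡i) (m∸n≤m m k)) m<i))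

coefficient-identity : ∀ P i {z a b c} → P i ≡ + a → P (suc i) ≡ + b → z ≡ + c →
  a ≡ 2 * (suc i * b) + c → (P -ₚ ((+ 2) ·ₚ D P)) i ≡ z
coefficient-identity P i {z} {a} {b} {c} Pᵢ≡a Pᵢ₊₁≡b z≡c recurrence = begin
  P i ℤ.- + 2 ℤ.* (+ suc i ℤ.* P (suc i))  ≡⟨ cong₂ (λ x y → x ℤ.- + 2 ℤ.* (+ suc i ℤ.* y)) Pᵢ≡a Pᵢ₊₁≡b ⟩
  + a ℤ.- + 2 ℤ.* (+ suc i ℤ.* + b)        ≡⟨ cong (λ x → + x ℤ.- + 2 ℤ.* (+ suc i ℤ.* + b)) recurrence ⟩
  + (d + c) ℤ.- + 2 ℤ.* (+ suc i ℤ.* + b)  ≡⟨ cong (λ y → + (d + c) ℤ.- + 2 ℤ.* y) (ℤ.pos-* (suc i) b) ⟨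
  + (d + c) ℤ.- + 2 ℤ.* + (suc i * b)      ≡⟨ cong (λ t → + (d + c) ℤ.- t) (ℤ.pos-* 2 (suc i * b)) ⟨
  + (d + c) ℤ.- + d                        ≡⟨ ℤ.[+m]-[+n]≡m⊖n (d + c) d ⟩
  (d + c) ⊖ d                              ≡⟨ ℤ.⊖-≥ (m≤m+n d c) ⟩
  + (d + c ∸ d)                            ≡⟨ cong +_ (m+n∸m≡n d c) ⟩
  + c                                      ≡⟨ z≡c ⟨
  z                                        ∎
  where
  d : ℕ
  d = 2 * (suc i * b)

lemma8p17 : (n : ℕ) → 2 ≤ n → (i : ℕ) → (C n -ₚ ((+ 2) ·ₚ D (C n))) i ≡ yₚ* (C (n ∸ 1)) i
lemma8p17 (suc zero) (s≤s ()) i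
lemma8p17 (suc (suc p)) _ zero =
  coefficient-identity (C (suc (suc p))) 0 (C-coefficient 0 (suc p) refl) (C-coefficient 1 p refl) refl
    (trans (T-diagonal p) (sym (trans (+-identityʳ _) (cong (2 *_) (*-identityˡ (T (suc p) p))))))
-- In terms of m = suc p and i = suc j: `less` is s = m ∸ i ≥ 1, `equal` is s = 0, `greater` is i > m.
lemma8p17 (suc (suc p)) _ (suc j) with compare j p
... | less .j r =
  coefficient-identity (C (suc (suc p))) (suc j)
    (C-coefficient (suc j) (suc r) (cong suc (sym (+-suc j r))))
    (C-coefficient (2 + j) r refl)
    (C-coefficient j (suc r) (sym (+-suc j r)))
    (T-recurrence j r)
... | equal .p =
  coefficient-identity (C (suc (suc p))) (suc p)
    (C-coefficient (suc p) 0 (sym (+-identityʳ (suc p))))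
    (C-coefficient-vanishing (suc p) ≤-refl)
    (C-coefficient p 0 (sym (+-identityʳ p)))
    (trans (T-zeroʳ (suc p)) (sym (trans (cong (λ t → 2 * t + T p 0) (*-zeroʳ (2 + p))) (T-zeroʳ p))))
... | greater .p k =
  coefficient-identity (C (suc (suc p))) (suc j)
    (C-coefficient-vanishing (suc p) (s≤s p<j))
    (C-coefficient-vanishing (suc p) (m<n⇒m<1+n (s≤s p<j)))
    (C-coefficient-vanishing p p<j)
    (sym (cong (λ t → 2 * t + 0) (*-zeroʳ (2 + j))))
  where
  p<j : p < suc (p + k)
  p<j = s≤s (m≤m+n p k)
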